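{- Let $(B_1|\dots|B_{k-1}|B_k)$ be an ordered multiset partition. Then \[ \mathrm{minimaj}(B_1|\dots|B_{k-1}|B_k)=\mathrm{minimaj}(B_1|\dots|B_{k-1}|\{\min(B_k)\}). \]
   Context: An ordered multiset partition is a sequence $(B_1|\dots|B_k)$ of nonempty finite sets of positive integers (no repeated letters within a block). $W(\mu)$ is the set of words obtained by writing the blocks in order with letters within each block in any order; $\mathrm{maj}(w)=\sum_{p:w_p>w_{p+1}}p$ and $\mathrm{minimaj}(\mu)=\min\{\mathrm{maj}(w):w\in W(\mu)\}$. -}

module Defs where

open import Data.Nat using (ℕ; zero; suc; _+_; _<_; _<?_; _≤_; _⊓_)
open import Data.Bool using (if_then_else_)
open import Data.List using (List; []; _∷_; concat; foldr)
open import Data.List.Relation.Unary.All using (All)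
open import Data.List.Relation.Unary.Unique.Propositional using (Unique)
open import Data.List.Relation.Binary.Pointwise using (Pointwise)
open import Data.List.Relation.Binary.Permutation.Propositional using (_↭_)
open import Data.Product using (Σ; _×_; ∃-syntax)
open import Relation.Nullary using (does)
open import Relation.Binary.PropositionalEquality using (_≡_)

-- A block is a list of letters (its order is irrelevant; it is only used
-- up to permutation).
data NonEmpty {A : Set} : List A → Set where
  nonEmpty : ∀ {x xs} → NonEmpty (x ∷ xs)

ValidBlock : List ℕ → Set
ValidBlock B = NonEmpty B × All (λ x → 0 < x) B × Unique B

OMP : List (List ℕ) → Set
OMP μ = All ValidBlock μ

_∈W_ : List ℕ → List (List ℕ) → Set
w ∈W μ = ∃[ ws ] (Pointwise _↭_ ws μ × w ≡ concat ws)

-- maj(w) = Σ_{p : w_p > w_{p+1}} p   (positions 1-indexed)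
majFrom : ℕ → List ℕ → ℕ
majFrom p []           = 0
majFrom p (x ∷ [])     = 0
majFrom p (x ∷ y ∷ w)  = (if does (y <? x) then p else 0) + majFrom (suc p) (y ∷ w)

maj : List ℕ → ℕ
maj = majFrom 1

IsMinimaj : List (List ℕ) → ℕ → Set
IsMinimaj μ m = (∃[ w ] (w ∈W μ × maj w ≡ m)) × (∀ w → w ∈W μ → m ≤ maj w)

minBlock : ℕ → List ℕ → ℕ
minBlock b bs = foldr _⊓_ b bs

-- Shrinking the last block to its minimum c never increases maj: a word ending in a
-- permutation v of B_k is no better than the same prefix followed by c alone, since if c
-- is below the preceding letter x, then either v starts below x or c occurs later in v,
-- below some earlier letter of v; either way v has a descent at a position at least as large.
-- Conversely, writing B_k in increasing order after the prefix adds no descent, and that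
-- order starts with c.  So the two sets of maj values have the same minimum.
module Submission where

open import Defs
open import Data.Nat using (ℕ)
open import Data.List using (List; []; _∷_; _++_)
open import Data.Product using (_×_; ∃-syntax)

open import Data.Nat using (suc; _+_; _<ᵇ_; _≤_; _<_; _⊓_; z≤n)
open import Data.Nat.Properties
  using (≤-refl; ≤-trans; ≤-antisym; ≤-reflexive; <-≤-trans; ≮⇒≥; n≤1+n; m≤m+n;
         +-monoʳ-≤; +-identityʳ; <⇒≱; <ᵇ-reflects-<; ⊓-sel; m⊓n≤m; m⊓n≤n; ≤-decTotalOrder)
open import Data.List using ([_]; concat; concatMap; map)
open import Data.List.Properties using (concat-++; ++-identityʳ; ++-assoc; foldr-preservesᵒ)
open import Data.List.Extrema.Nat using (argmin; argmin-all; f[argmin]≤f[xs])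
open import Data.List.Membership.Propositional using (_∈_; find; lose)
open import Data.List.Membership.Propositional.Properties
  using (∈-concatMap⁺; ∈-concatMap⁻; ∈-map⁺; ∈-map⁻; ∈-∃++; foldr-selective)
open import Data.List.Relation.Unary.All using (lookup; tabulate)
open import Data.List.Relation.Unary.Any using (Any; here; there)
import Data.List.Relation.Unary.Any as Any
open import Data.List.Relation.Unary.Linked using (Linked; []; [-]; _∷_)
open import Data.List.Relation.Unary.Linked.Properties using (Linked⇒All)
open import Data.List.Relation.Binary.Pointwise using ([]; _∷_; ++⁺)
import Data.List.Relation.Binary.Pointwise as Pointwise
open import Data.List.Relation.Binary.Permutation.Propositional
  using (_↭_; ↭-refl; ↭-sym; ↭-trans; prep; swap)
open import Data.List.Relation.Binary.Permutation.Propositional.Properties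
  using (∈-resp-↭; drop-mid; ↭-empty-inv; ↭-singleton-inv; ¬x∷xs↭[])
open import Data.List.Sort ≤-decTotalOrder using (sort; sort-↭; sort-↗)
open import Data.Product using (_,_; ∃₂)
open import Data.Sum using (_⊎_; inj₁; inj₂)
open import Data.Empty using (⊥-elim)
open import Data.Bool using (true; false)
open import Relation.Nullary.Reflects using (ofʸ; ofⁿ)
open import Relation.Binary.PropositionalEquality using (_≡_; refl; sym; trans; cong)

minBlock∈ : ∀ b bs → minBlock b bs ∈ b ∷ bs
minBlock∈ b bs with foldr-selective ⊓-sel b bs
... | inj₁ min≡b   = here min≡b
... | inj₂ min∈bs  = there min∈bs

minBlock≤ : ∀ {b bs z} → z ∈ b ∷ bs → minBlock b bs ≤ z
minBlock≤ {b} {bs} {z} z∈ = foldr-preservesᵒ ⊓-≤ b bs (head-or-tail z∈)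
  where
  ⊓-≤ : ∀ x y → x ≤ z ⊎ y ≤ z → x ⊓ y ≤ z
  ⊓-≤ x y (inj₁ x≤z) = ≤-trans (m⊓n≤m x y) x≤z
  ⊓-≤ x y (inj₂ y≤z) = ≤-trans (m⊓n≤n x y) y≤z
  head-or-tail : ∀ {x xs} → z ∈ x ∷ xs → x ≤ z ⊎ Any (_≤ z) xs
  head-or-tail (here refl) = inj₁ ≤-refl
  head-or-tail (there z∈xs) = inj₂ (Any.map (λ { refl → ≤-refl }) z∈xs)

descent⇒start≤majFrom : ∀ q y v {z} → z ∈ v → z < y → q ≤ majFrom q (y ∷ v)
descent⇒start≤majFrom q y (y′ ∷ v) z∈ z<y with y′ <ᵇ y | <ᵇ-reflects-< y′ y
... | true  | ofʸ _ = m≤m+n q _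
... | false | ofⁿ y′≮y with z∈
...   | here refl = ⊥-elim (y′≮y z<y)
...   | there z∈v = ≤-trans (n≤1+n q)
                      (descent⇒start≤majFrom (suc q) y′ v z∈v (<-≤-trans z<y (≮⇒≥ y′≮y)))

majFrom-sorted : ∀ q {l} → Linked _≤_ l → majFrom q l ≡ 0
majFrom-sorted q []  = refl
majFrom-sorted q [-] = refl
majFrom-sorted q {x ∷ y ∷ l} (x≤y ∷ sorted) with y <ᵇ x | <ᵇ-reflects-< y x
... | true  | ofʸ y<x = ⊥-elim (<⇒≱ y<x x≤y)
... | false | ofⁿ _   = majFrom-sorted (suc q) sorted

majFrom-++-sorted : ∀ p u {c t} → Linked _≤_ (c ∷ t) →
                    majFrom p (u ++ c ∷ t) ≡ majFrom p (u ++ [ c ])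
majFrom-++-sorted p []          sorted = majFrom-sorted p sorted
majFrom-++-sorted p (x ∷ [])    sorted = cong (_ +_) (majFrom-sorted (suc p) sorted)
majFrom-++-sorted p (x ∷ x′ ∷ u) sorted = cong (_ +_) (majFrom-++-sorted (suc p) (x′ ∷ u) sorted)

majFrom-++-∈≤ : ∀ p u {c v} → c ∈ v → majFrom p (u ++ [ c ]) ≤ majFrom p (u ++ v)
majFrom-++-∈≤ p [] c∈ = z≤n
majFrom-++-∈≤ p (x ∷ []) {c} {y ∷ v} c∈ with c <ᵇ x | <ᵇ-reflects-< c x
... | false | ofⁿ _ = z≤n
... | true  | ofʸ c<x with y <ᵇ x | <ᵇ-reflects-< y x
...   | true  | ofʸ _ = +-monoʳ-≤ p z≤n
...   | false | ofⁿ y≮x with c∈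
...     | here refl = ⊥-elim (y≮x c<x)
...     | there c∈v = ≤-trans (≤-reflexive (+-identityʳ p)) (≤-trans (n≤1+n p)
                        (descent⇒start≤majFrom (suc p) y v c∈v (<-≤-trans c<x (≮⇒≥ y≮x))))
majFrom-++-∈≤ p (x ∷ x′ ∷ u) c∈ = +-monoʳ-≤ _ (majFrom-++-∈≤ (suc p) (x′ ∷ u) c∈)

∈W-++⁺ : ∀ {μ ν w₁ w₂} → w₁ ∈W μ → w₂ ∈W ν → (w₁ ++ w₂) ∈W (μ ++ ν)
∈W-++⁺ (ws₁ , pw₁ , refl) (ws₂ , pw₂ , refl) = ws₁ ++ ws₂ , ++⁺ pw₁ pw₂ , concat-++ ws₁ ws₂

∈W-++⁻ : ∀ μ {ν w} → w ∈W (μ ++ ν) → ∃₂ λ w₁ w₂ → w₁ ∈W μ × w₂ ∈W ν × w ≡ w₁ ++ w₂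
∈W-++⁻ []      w∈ = [] , _ , ([] , [] , refl) , w∈ , refl
∈W-++⁻ (B ∷ μ) (p ∷ ws , p↭B ∷ pw , refl) with ∈W-++⁻ μ (ws , pw , refl)
... | w₁ , w₂ , (ws₁ , pw₁ , refl) , w₂∈ , eq =
  p ++ w₁ , w₂ , (p ∷ ws₁ , p↭B ∷ pw₁ , refl) , w₂∈ ,
  trans (cong (p ++_) eq) (sym (++-assoc p w₁ w₂))

∈W-[-]⁺ : ∀ {p B} → p ↭ B → p ∈W [ B ]
∈W-[-]⁺ {p} p↭B = [ p ] , p↭B ∷ [] , sym (++-identityʳ p)

∈W-[-]⁻ : ∀ {p B} → p ∈W [ B ] → p ↭ B
∈W-[-]⁻ (q ∷ [] , q↭B ∷ [] , refl) rewrite ++-identityʳ q = q↭B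

sortedFromMinBlock : ∀ b bs → ∃[ t ] (minBlock b bs ∷ t ↭ b ∷ bs × Linked _≤_ (minBlock b bs ∷ t))
sortedFromMinBlock b bs = arrange (sort (b ∷ bs)) (sort-↭ (b ∷ bs)) (sort-↗ (b ∷ bs))
  where
  arrange : ∀ l → l ↭ b ∷ bs → Linked _≤_ l →
            ∃[ t ] (minBlock b bs ∷ t ↭ b ∷ bs × Linked _≤_ (minBlock b bs ∷ t))
  arrange []      l↭ sorted = ⊥-elim (¬x∷xs↭[] (↭-sym l↭))
  arrange (h ∷ t) l↭ sorted
    with ≤-antisym (lookup (Linked⇒All ≤-trans ≤-refl sorted) (∈-resp-↭ (↭-sym l↭) (minBlock∈ b bs)))
                   (minBlock≤ (∈-resp-↭ l↭ (here refl)))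
  ... | refl = t , l↭ , sorted

MajDominatedBy : List (List ℕ) → List (List ℕ) → Set
MajDominatedBy μ ν = ∀ {w} → w ∈W μ → ∃[ w′ ] (w′ ∈W ν × maj w′ ≤ maj w)

IsMinimaj-transfer : ∀ {μ ν m} → MajDominatedBy μ ν → MajDominatedBy ν μ →
                     IsMinimaj ν m → IsMinimaj μ m
IsMinimaj-transfer {μ} μ≼ν ν≼μ ((w , w∈ν , refl) , ν-lower) with ν≼μ w∈ν
... | w′ , w′∈μ , w′≤w = (w′ , w′∈μ , ≤-antisym w′≤w (μ-lower w′∈μ)) , λ _ → μ-lower
  where
  μ-lower : ∀ {x} → x ∈W μ → maj w ≤ maj x
  μ-lower x∈μ with μ≼ν x∈μ
  ... | x′ , x′∈ν , x′≤x = ≤-trans (ν-lower x′ x′∈ν) x′≤x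

shrinkLastBlock : ∀ μ b bs → MajDominatedBy (μ ++ [ b ∷ bs ]) (μ ++ [ [ minBlock b bs ] ])
shrinkLastBlock μ b bs w∈ with ∈W-++⁻ μ w∈
... | w₁ , v , w₁∈@(ws₁ , _ , refl) , v∈ , refl =
  concat ws₁ ++ [ minBlock b bs ] , ∈W-++⁺ w₁∈ (∈W-[-]⁺ ↭-refl) ,
  majFrom-++-∈≤ 1 (concat ws₁) (∈-resp-↭ (↭-sym (∈W-[-]⁻ v∈)) (minBlock∈ b bs))

growLastBlock : ∀ μ b bs → MajDominatedBy (μ ++ [ [ minBlock b bs ] ]) (μ ++ [ b ∷ bs ])
growLastBlock μ b bs w∈ with ∈W-++⁻ μ w∈
... | w₁ , v , w₁∈@(ws₁ , _ , refl) , v∈ , refl with ↭-singleton-inv (∈W-[-]⁻ v∈)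
...   | refl with sortedFromMinBlock b bs
...     | t , t↭ , sorted =
  concat ws₁ ++ minBlock b bs ∷ t , ∈W-++⁺ w₁∈ (∈W-[-]⁺ t↭) ,
  ≤-reflexive (majFrom-++-sorted 1 (concat ws₁) sorted)

insertions : ∀ {A : Set} → A → List A → List (List A)
insertions x []       = [ [ x ] ]
insertions x (y ∷ ys) = (x ∷ y ∷ ys) ∷ map (y ∷_) (insertions x ys)

permutations : ∀ {A : Set} → List A → List (List A)
permutations []       = [ [] ]
permutations (x ∷ xs) = concatMap (insertions x) (permutations xs)

module _ {A : Set} where

  ∈-insertions⁻ : ∀ {p} x (ys : List A) → p ∈ insertions x ys → p ↭ x ∷ ys
  ∈-insertions⁻ x []       (here refl) = ↭-refl
  ∈-insertions⁻ x (y ∷ ys) (here refl) = ↭-refl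
  ∈-insertions⁻ x (y ∷ ys) (there p∈) with ∈-map⁻ (y ∷_) p∈
  ... | q , q∈ , refl = ↭-trans (prep y (∈-insertions⁻ x ys q∈)) (swap y x ↭-refl)

  ∈-insertions⁺ : ∀ x (as bs : List A) → as ++ x ∷ bs ∈ insertions x (as ++ bs)
  ∈-insertions⁺ x []       []       = here refl
  ∈-insertions⁺ x []       (b ∷ bs) = here refl
  ∈-insertions⁺ x (a ∷ as) bs       = there (∈-map⁺ (a ∷_) (∈-insertions⁺ x as bs))

  ∈-permutations⁻ : ∀ {p} (xs : List A) → p ∈ permutations xs → p ↭ xs
  ∈-permutations⁻ []       (here refl) = ↭-refl
  ∈-permutations⁻ (x ∷ xs) p∈ with find (∈-concatMap⁻ (insertions x) {xs = permutations xs} p∈)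
  ... | q , q∈ , p∈q = ↭-trans (∈-insertions⁻ x q p∈q) (prep x (∈-permutations⁻ xs q∈))

  ∈-permutations⁺ : ∀ {p} (xs : List A) → p ↭ xs → p ∈ permutations xs
  ∈-permutations⁺ []       p↭ with refl ← ↭-empty-inv p↭ = here refl
  ∈-permutations⁺ (x ∷ xs) p↭ with ∈-∃++ (∈-resp-↭ (↭-sym p↭) (here {xs = xs} refl))
  ... | as , bs , refl = ∈-concatMap⁺ (insertions x)
    (lose (∈-permutations⁺ xs (drop-mid as [] p↭)) (∈-insertions⁺ x as bs))

words : List (List ℕ) → List (List ℕ)
words []      = [ [] ]
words (B ∷ μ) = concatMap (λ p → map (p ++_) (words μ)) (permutations B)

∈-words⁻ : ∀ μ {w} → w ∈ words μ → w ∈W μ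
∈-words⁻ []      (here refl) = [] , [] , refl
∈-words⁻ (B ∷ μ) w∈ with find (∈-concatMap⁻ (λ p → map (p ++_) (words μ)) {xs = permutations B} w∈)
... | p , p∈ , w∈p with ∈-map⁻ (p ++_) w∈p
...   | w′ , w′∈ , refl = ∈W-++⁺ {μ = [ B ]} (∈W-[-]⁺ (∈-permutations⁻ B p∈)) (∈-words⁻ μ w′∈)

∈-words⁺ : ∀ μ {w} → w ∈W μ → w ∈ words μ
∈-words⁺ []      ([] , [] , refl) = here refl
∈-words⁺ (B ∷ μ) (p ∷ ws , p↭B ∷ pw , refl) =
  ∈-concatMap⁺ (λ q → map (q ++_) (words μ))
    (lose (∈-permutations⁺ B p↭B) (∈-map⁺ (p ++_) (∈-words⁺ μ (ws , pw , refl))))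

minimaj-exists : ∀ μ → ∃[ m ] IsMinimaj μ m
minimaj-exists μ =
  maj w , (w , argmin-all maj concat∈W (tabulate (∈-words⁻ μ)) , refl) ,
  λ x x∈ → lookup (f[argmin]≤f[xs] (concat μ) (words μ)) (∈-words⁺ μ x∈)
  where
  concat∈W : concat μ ∈W μ
  concat∈W = μ , Pointwise.refl ↭-refl , refl
  w : List ℕ
  w = argmin maj (concat μ) (words μ)

lemma3p5 : (Bs : List (List ℕ)) (b : ℕ) (bs : List ℕ) →
    OMP (Bs ++ ((b ∷ bs) ∷ [])) →
    ∃[ m ] (IsMinimaj (Bs ++ ((b ∷ bs) ∷ [])) m
            × IsMinimaj (Bs ++ ((minBlock b bs ∷ []) ∷ [])) m)
lemma3p5 Bs b bs _ with minimaj-exists (Bs ++ [ [ minBlock b bs ] ])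
... | m , minimaj =
  m , IsMinimaj-transfer (shrinkLastBlock Bs b bs) (growLastBlock Bs b bs) minimaj , minimaj
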